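{- Let $G$ be a graph, let $S$ be a distinguishing set of $G$ and let $\emptyset\neq S'\subseteq S$ with $r'=|S'|$. Let $F\subseteq E(G^S)$ be a set of edges consisting of exactly two edges with label $u$ for each $u\in S'$, and let $H$ be the subgraph of $G^S$ induced by $F$. Then $|V(H)|\ge\frac32 r'+1$.
   Context: $N(x)$ is the open neighborhood of $x$ in $G$. A set $S$ of vertices is distinguishing if $N(x)\cap S\neq N(y)\cap S$ for all distinct $x,y\notin S$. The $S$-associated graph $G^S$ is the edge-labeled graph with vertex set $V(G)\setminus S$, where $x,y$ are adjacent iff $N(x)\cap S$ and $N(y)\cap S$ differ in exactly one vertex $u\in S$, and the edge $xy$ then has label $\ell(xy)=u$. The subgraph induced by an edge set $F$ has edge set $F$ and vertex set the endpoints of edges of $F$. -}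

module Defs where

open import Data.Nat using (ℕ; _<_)
open import Data.Bool using (Bool; true; false; _∨_)
open import Data.Fin using (Fin; toℕ; _≟_)
open import Data.Fin.Subset using (Subset; _∈_; _∉_; _⊆_)
open import Data.Vec using (tabulate)
open import Data.List using (List)
open import Data.Bool.ListAction using (any)
open import Data.List.Membership.Propositional using () renaming (_∈_ to _∈ₗ_)
open import Data.List.Relation.Unary.Unique.Propositional using (Unique)
open import Data.Product using (_×_; _,_; Σ; ∃; proj₁; proj₂)
open import Data.Sum using (_⊎_)
open import Relation.Nullary using (¬_)
open import Relation.Nullary.Decidable using (⌊_⌋)
open import Relation.Binary.PropositionalEquality using (_≡_; _≢_)

record Graph (n : ℕ) : Set where
  field
    adj   : Fin n → Fin n → Bool
    sym   : ∀ x y → adj x y ≡ adj y x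
    irref : ∀ x → adj x x ≡ false
open Graph public

SameTrace : ∀ {n} → Graph n → Subset n → Fin n → Fin n → Set
SameTrace G S x y = ∀ u → u ∈ S → adj G x u ≡ adj G y u

Distinguishing : ∀ {n} → Graph n → Subset n → Set
Distinguishing G S = ∀ x y → x ∉ S → y ∉ S → x ≢ y → ¬ SameTrace G S x y

-- In G^S, xy is an edge with label u: x,y ∉ S and N(x)∩S, N(y)∩S differ
-- in exactly the vertex u ∈ S.
LabelledEdge : ∀ {n} → Graph n → Subset n → Fin n → Fin n → Fin n → Set
LabelledEdge G S x y u =
  x ∉ S × y ∉ S × u ∈ S × adj G x u ≢ adj G y u ×
  (∀ w → w ∈ S → w ≢ u → adj G x w ≡ adj G y w)

-- An (unordered) edge {x,y} is represented by the ordered pair (x , y) with x < y.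
Edge : ℕ → Set
Edge n = Fin n × Fin n

Ordered : ∀ {n} → Edge n → Set
Ordered (x , y) = toℕ x < toℕ y

HasLabel : ∀ {n} → Graph n → Subset n → Edge n → Fin n → Set
HasLabel G S (x , y) u = LabelledEdge G S x y u

-- F is a set of edges of G^S (a duplicate-free list of normalised pairs)
-- consisting of exactly two edges of label u for each u ∈ S' (and no others).
TwoPerLabel : ∀ {n} → Graph n → Subset n → Subset n → List (Edge n) → Set
TwoPerLabel {n} G S S' F =
  Unique F ×
  (∀ e → e ∈ₗ F → Ordered e × ∃ λ u → u ∈ S' × HasLabel G S e u) ×
  (∀ u → u ∈ S' → Σ (Edge n) λ e₁ → Σ (Edge n) λ e₂ →
      e₁ ∈ₗ F × e₂ ∈ₗ F × e₁ ≢ e₂ ×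
      HasLabel G S e₁ u × HasLabel G S e₂ u ×
      (∀ e → e ∈ₗ F → HasLabel G S e u → (e ≡ e₁ ⊎ e ≡ e₂)))

endpoints : ∀ {n} → List (Edge n) → Subset n
endpoints F = tabulate λ v → any (λ e → ⌊ v ≟ proj₁ e ⌋ ∨ ⌊ v ≟ proj₂ e ⌋) F

-- Refine V(H) by adjacency to the vertices of S, taken one at a time in some order; a set
-- of m vertices can be split into two nonempty parts at most m − 1 times. For u ∈ S′ each
-- of its two edges lies in a single current cell (its endpoints agree on S − u), and testing u
-- splits that cell. The two cells are distinct as soon as the non-neighbours of u on the two
-- edges have been separated; since S is distinguishing, they are separated by some w ∈ S − u,
-- and w comes before u either in the order or in the reversed order. So over the two orders
-- every label causes at least three splits: 3 r′ ≤ 2 (|V(H)| − 1).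

module Submission where

open import Defs hiding (sym)
open import Data.Bool using (Bool; true; false; not; _∧_; _∨_; _xor_; if_then_else_; T)
import Data.Bool as Bool
open import Data.Bool.Properties using (xor-same; ¬-not; T-≡; T-∨)
open import Data.Bool.ListAction using (any)
open import Data.Empty using (⊥-elim)
open import Data.Fin using (Fin; zero; suc; _≟_)
open import Data.Fin.Subset using (Subset; _∈_; _∉_; _⊆_; Nonempty; ∣_∣)
open import Data.Fin.Properties using (¬∀⟶∃¬; suc-injective)
open import Data.Fin.Subset.Properties using (_∈?_; drop-∷-⊆; x∈p⇒∣p-x∣<∣p∣)
open import Data.List using (List; []; _∷_; _++_; _∷ʳ_; map; reverse)
open import Data.Nat.ListAction using (sum)
open import Data.List.Properties using (map-∘; ++-assoc; ++-identityʳ; unfold-reverse)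
open import Data.List.Membership.Propositional using () renaming (_∈_ to _∈ₗ_; _∉_ to _∉ₗ_)
open import Data.List.Relation.Unary.All using (All; []; _∷_)
import Data.List.Relation.Unary.All as All
open import Data.List.Relation.Unary.All.Properties using (All¬⇒¬Any) renaming (map⁺ to All-map⁺)
open import Data.List.Relation.Unary.Any using (here; there)
import Data.List.Relation.Unary.Any as Any
open import Data.List.Relation.Unary.Any.Properties using (any⁺)
open import Data.List.Relation.Binary.Permutation.Propositional using (_↭_; ↭-sym; ↭⇒↭ₛ)
open import Data.List.Relation.Binary.Permutation.Propositional.Properties using (↭-reverse; ∈-resp-↭; All-resp-↭)
import Data.List.Relation.Binary.Permutation.Setoid.Properties as Permutationₛ
open import Data.List.Membership.Propositional.Properties using (∈-++⁺ˡ; ∈-++⁺ʳ; ∈-map⁺)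
open import Data.List.Relation.Unary.Unique.Propositional using (Unique; []; _∷_)
open import Data.List.Relation.Unary.Unique.Propositional.Properties using () renaming (map⁺ to Unique-map⁺)
open import Data.Nat using (ℕ; zero; suc; _+_; _*_; _∸_; _≤_; s≤s; z≤n)
open import Data.Nat.Properties using (module ≤-Reasoning; *-distribˡ-+; *-suc; +-comm; +-monoˡ-≤; +-identityʳ; +-assoc; +-suc; +-mono-≤; +-monoʳ-≤; <-asym; m∸n≤m; ≤-refl; ≤-trans; m≤n+m; +-commutativeSemigroup)
open import Algebra.Properties.CommutativeSemigroup +-commutativeSemigroup using (interchange)
open import Data.Product using (_×_; _,_; ∃; proj₁; proj₂)
open import Data.Sum using (_⊎_; inj₁; inj₂)
open import Data.Vec using ([]; _∷_; tabulate)
import Data.Vec as V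
open import Function using (_∘_)
open import Function.Bundles using (Equivalence)
open import Relation.Nullary using (Dec; does; yes; no)
open import Relation.Nullary.Decidable using (⌊_⌋; fromWitness; decidable-stable; _→-dec_)
open import Relation.Binary.PropositionalEquality using (_≡_; _≢_; refl; sym; trans; cong; cong₂; subst; module ≡-Reasoning; setoid)

boolToℕ : Bool → ℕ
boolToℕ true  = 1
boolToℕ false = 0

size : ∀ {n} → (Fin n → Bool) → ℕ
size f = ∣ tabulate f ∣

size-∷ : ∀ {n} (f : Fin (suc n) → Bool) → size f ≡ boolToℕ (f zero) + size (f ∘ suc)
size-∷ f with f zero
... | true  = refl
... | false = refl

size-+ : ∀ {n} (f g h : Fin n → Bool) →
         (∀ v → boolToℕ (f v) ≡ boolToℕ (g v) + boolToℕ (h v)) →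
         size f ≡ size g + size h
size-+ {zero}  f g h f≡g+h = refl
size-+ {suc n} f g h f≡g+h = begin
  size f                                                   ≡⟨ size-∷ f ⟩
  boolToℕ (f zero) + size (f ∘ suc)                        ≡⟨ cong₂ _+_ (f≡g+h zero) (size-+ _ _ _ (f≡g+h ∘ suc)) ⟩
  (boolToℕ (g zero) + boolToℕ (h zero)) + (size (g ∘ suc) + size (h ∘ suc))
    ≡⟨ interchange (boolToℕ (g zero)) (boolToℕ (h zero)) (size (g ∘ suc)) (size (h ∘ suc)) ⟩
  (boolToℕ (g zero) + size (g ∘ suc)) + (boolToℕ (h zero) + size (h ∘ suc))
    ≡⟨ sym (cong₂ _+_ (size-∷ g) (size-∷ h)) ⟩
  size g + size h                                          ∎
  where open ≡-Reasoning

size-pos : ∀ {n} (f : Fin n → Bool) v → f v ≡ true → 1 ≤ size f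
size-pos f zero    fv≡true rewrite size-∷ f | fv≡true = s≤s z≤n
size-pos f (suc v) fv≡true rewrite size-∷ f =
  ≤-trans (size-pos (f ∘ suc) v fv≡true) (m≤n+m _ (boolToℕ (f zero)))

prefixSum : ∀ {A : Set} → (List A → A → ℕ) → List A → List A → ℕ
prefixSum f seen []       = 0
prefixSum f seen (u ∷ us) = f seen u + prefixSum f (seen ∷ʳ u) us

prefixSum-∷ʳ : ∀ {A : Set} (f : List A → A → ℕ) seen us u →
               prefixSum f seen (us ∷ʳ u) ≡ prefixSum f seen us + f (seen ++ us) u
prefixSum-∷ʳ f seen []        u rewrite ++-identityʳ seen = +-identityʳ (f seen u)
prefixSum-∷ʳ f seen (u′ ∷ us) u
  rewrite prefixSum-∷ʳ f (seen ∷ʳ u′) us u | ++-assoc seen (u′ ∷ []) us =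
  sym (+-assoc (f seen u′) _ _)

prefixSum-split : ∀ {A : Set} (f g h : List A → A → ℕ) t →
                  (∀ seen u → f (t ∷ seen) u ≡ g seen u + h seen u) →
                  ∀ seen us → prefixSum f (t ∷ seen) us ≡ prefixSum g seen us + prefixSum h seen us
prefixSum-split f g h t f≡g+h seen []       = refl
prefixSum-split f g h t f≡g+h seen (u ∷ us)
  rewrite f≡g+h seen u | prefixSum-split f g h t f≡g+h (seen ∷ʳ u) us =
  interchange (g seen u) (h seen u) _ _

1+[m∸1]+[n∸1]≡m+n∸1 : ∀ {m n} → 1 ≤ m → 1 ≤ n → 1 + (m ∸ 1) + (n ∸ 1) ≡ m + n ∸ 1
1+[m∸1]+[n∸1]≡m+n∸1 {suc m} {suc n} _ _ = sym (+-suc m n)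

[m∸1]+[n∸1]≤m+n∸1 : ∀ m n → (m ∸ 1) + (n ∸ 1) ≤ m + n ∸ 1
[m∸1]+[n∸1]≤m+n∸1 zero    n = ≤-refl
[m∸1]+[n∸1]≤m+n∸1 (suc m) n = +-monoʳ-≤ m (m∸n≤m n 1)

-- The number of cells meeting {a, b}, where x and y say whether a and b lie in the current
-- cell and d whether a previous test has separated them.
meet : Bool → Bool → Bool → ℕ
meet true  true  d = 1 + boolToℕ d
meet true  false _ = 1
meet false true  _ = 1
meet false false _ = 0

meet-≤1 : ∀ x y → meet x y false ≤ 1
meet-≤1 true  true  = ≤-refl
meet-≤1 true  false = ≤-refl
meet-≤1 false true  = ≤-refl
meet-≤1 false false = z≤n

meet-split : ∀ x y α β d →
  meet x y ((α xor β) ∨ d) ≡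
  meet (x ∧ not (α xor false)) (y ∧ not (β xor false)) d + meet (x ∧ not (α xor true)) (y ∧ not (β xor true)) d
meet-split true  true  false false d = sym (+-identityʳ _)
meet-split true  true  false true  d = refl
meet-split true  true  true  false d = refl
meet-split true  true  true  true  d = refl
meet-split true  false false β     d = refl
meet-split true  false true  β     d = refl
meet-split false true  α     false d = refl
meet-split false true  α     true  d = refl
meet-split false false α     β     d = refl

module Refinement {n} (test : Fin n → Fin n → Bool) (V : Fin n → Bool) (S : Subset n) where

  Context : Set
  Context = List (Fin n × Bool)

  infix 7 _⊨_
  _⊨_ : Fin n → Context → Bool
  v ⊨ []            = true
  v ⊨ ((w , b) ∷ C) = v ⊨ C ∧ not (test v w xor b)

  cell : Context → Fin n → Bool
  cell C v = v ⊨ C ∧ V v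

  Occupied : Context → Set
  Occupied C = ∃ λ v → cell C v ≡ true

  Splits : Context → Fin n → Set
  Splits C w = Occupied ((w , false) ∷ C) × Occupied ((w , true) ∷ C)

  size-cell-split : ∀ C w → size (cell C) ≡ size (cell ((w , false) ∷ C)) + size (cell ((w , true) ∷ C))
  size-cell-split C w = size-+ _ _ _ (λ v → split (v ⊨ C) (test v w) (V v))
    where
    split : ∀ m x a → boolToℕ (m ∧ a) ≡
            boolToℕ ((m ∧ not (x xor false)) ∧ a) + boolToℕ ((m ∧ not (x xor true)) ∧ a)
    split true  true  true  = refl
    split true  false true  = refl
    split true  true  false = refl
    split true  false false = refl
    split false x     a     = refl

  Fresh : Fin n → Context → Set
  Fresh w C = All (λ tb → proj₁ tb ∈ S × proj₁ tb ≢ w) C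

  Charge : Set
  Charge = Context → Fin n → ℕ

  IsSplitCharge : Charge → Set
  IsSplitCharge c = ∀ C w → Fresh w C → c C w ≡ 0 ⊎ (c C w ≤ 1 × Splits C w)

  total : Charge → Context → List (Fin n) → ℕ
  total c C []       = 0
  total c C (w ∷ ws) = c C w + total c ((w , false) ∷ C) ws + total c ((w , true) ∷ C) ws

  -- Charged cells split into two nonempty cells; on an empty cell the bound 0 ∸ 1 = 0 is
  -- met because no charge can be placed below it.
  total≤size∸1 : ∀ {c} → IsSplitCharge c → ∀ ws C → Unique ws → All (_∈ S) ws →
                 All (λ tb → proj₁ tb ∈ S × proj₁ tb ∉ₗ ws) C →
                 total c C ws ≤ size (cell C) ∸ 1
  total≤size∸1 split []       C _ _ _ = z≤n
  total≤size∸1 {c} split (w ∷ ws) C (w∉ws ∷ ws!) (w∈S ∷ ws⊆S) inv rewrite size-cell-split C w =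
    by-cases (split C w (All.map (λ (t∈S , t∉) → t∈S , t∉ ∘ here) inv))
    where
    C₀ C₁ : Context
    C₀ = (w , false) ∷ C
    C₁ = (w , true) ∷ C

    below : ∀ b → total c ((w , b) ∷ C) ws ≤ size (cell ((w , b) ∷ C)) ∸ 1
    below b = total≤size∸1 split ws _ ws! ws⊆S
      ((w∈S , All¬⇒¬Any w∉ws) ∷ All.map (λ (t∈S , t∉) → t∈S , t∉ ∘ there) inv)

    by-cases : c C w ≡ 0 ⊎ (c C w ≤ 1 × Splits C w) →
               c C w + total c C₀ ws + total c C₁ ws ≤ size (cell C₀) + size (cell C₁) ∸ 1
    by-cases (inj₁ c≡0) rewrite c≡0 =
      ≤-trans (+-mono-≤ (below false) (below true)) ([m∸1]+[n∸1]≤m+n∸1 (size (cell C₀)) _)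
    by-cases (inj₂ (c≤1 , (v₀ , v₀∈C₀) , (v₁ , v₁∈C₁))) = begin
      c C w + total c C₀ ws + total c C₁ ws
        ≤⟨ +-mono-≤ (+-mono-≤ c≤1 (below false)) (below true) ⟩
      1 + (size (cell C₀) ∸ 1) + (size (cell C₁) ∸ 1)
        ≡⟨ 1+[m∸1]+[n∸1]≡m+n∸1 (size-pos _ v₀ v₀∈C₀) (size-pos _ v₁ v₁∈C₁) ⟩
      size (cell C₀) + size (cell C₁) ∸ 1 ∎
      where open ≤-Reasoning

  leafSum : (Context → ℕ) → Context → List (Fin n) → ℕ
  leafSum g C []       = g C
  leafSum g C (w ∷ ws) = leafSum g ((w , false) ∷ C) ws + leafSum g ((w , true) ∷ C) ws

  -- Regroups the charges by test instead of by cell: the cells present when w is tested are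
  -- the leaves over the tests preceding w.
  total≡prefixSum : ∀ c C ws → total c C ws ≡ prefixSum (λ seen w → leafSum (λ D → c D w) C seen) [] ws
  total≡prefixSum c C []       = refl
  total≡prefixSum c C (w ∷ ws) = begin
    c C w + total c C₀ ws + total c C₁ ws
      ≡⟨ cong₂ (λ x y → c C w + x + y) (total≡prefixSum c C₀ ws) (total≡prefixSum c C₁ ws) ⟩
    c C w + prefixSum (costFrom C₀) [] ws + prefixSum (costFrom C₁) [] ws
      ≡⟨ +-assoc (c C w) _ _ ⟩
    c C w + (prefixSum (costFrom C₀) [] ws + prefixSum (costFrom C₁) [] ws)
      ≡⟨ cong (c C w +_) (sym (prefixSum-split _ _ _ w (λ _ _ → refl) [] ws)) ⟩
    c C w + prefixSum (costFrom C) (w ∷ []) ws ∎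
    where
    open ≡-Reasoning
    C₀ C₁ : Context
    C₀ = (w , false) ∷ C
    C₁ = (w , true) ∷ C
    costFrom : Context → List (Fin n) → Fin n → ℕ
    costFrom D seen u = leafSum (λ E → c E u) D seen

  separated : List (Fin n) → Fin n → Fin n → Bool
  separated ws a b = any (λ w → test a w xor test b w) ws

  leafSum-meet : ∀ a b C ws →
    leafSum (λ D → meet (a ⊨ D) (b ⊨ D) false) C ws ≡ meet (a ⊨ C) (b ⊨ C) (separated ws a b)
  leafSum-meet a b C []       = refl
  leafSum-meet a b C (w ∷ ws)
    rewrite leafSum-meet a b ((w , false) ∷ C) ws | leafSum-meet a b ((w , true) ∷ C) ws =
    sym (meet-split (a ⊨ C) (b ⊨ C) (test a w) (test b w) (separated ws a b))

  Twins : Fin n → Fin n → Fin n → Set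
  Twins u a a′ = V a ≡ true × V a′ ≡ true × test a u ≢ test a′ u ×
                 (∀ w → w ∈ S → w ≢ u → test a w ≡ test a′ w)

  ⊨-agree : ∀ {u a a′} C → Fresh u C → (∀ w → w ∈ S → w ≢ u → test a w ≡ test a′ w) → a ⊨ C ≡ a′ ⊨ C
  ⊨-agree []            []                   agree = refl
  ⊨-agree ((w , b) ∷ C) ((w∈S , w≢u) ∷ fresh) agree
    rewrite ⊨-agree C fresh agree | agree w w∈S w≢u = refl

  ∈-child : ∀ {a u b} C → test a u ≡ b → V a ≡ true → a ⊨ C ≡ true → cell ((u , b) ∷ C) a ≡ true
  ∈-child {b = b} C refl Va a⊨C rewrite a⊨C | Va | xor-same b = refl

  twins-split : ∀ {u a a′ C} → Twins u a a′ → Fresh u C → a ⊨ C ≡ true → Splits C u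
  twins-split {u} {a} {a′} {C} (Va , Va′ , a≢a′ , agree) fresh a⊨C with test a u in eq | test a′ u in eq′
  ... | false | true  = (a , ∈-child C eq Va a⊨C) , (a′ , ∈-child C eq′ Va′ a′⊨C)
    where a′⊨C = trans (sym (⊨-agree C fresh agree)) a⊨C
  ... | true  | false = (a′ , ∈-child C eq′ Va′ a′⊨C) , (a , ∈-child C eq Va a⊨C)
    where a′⊨C = trans (sym (⊨-agree C fresh agree)) a⊨C
  ... | false | false = ⊥-elim (a≢a′ refl)
  ... | true  | true  = ⊥-elim (a≢a′ refl)

  module Labelling (lab : Fin n → Bool) (p q : Fin n → Fin n) where

    touch : Charge
    touch C u = if lab u then meet (p u ⊨ C) (q u ⊨ C) false else 0

    HaveTwins : Set
    HaveTwins = ∀ u → lab u ≡ true → (∃ λ a → Twins u (p u) a) × (∃ λ b → Twins u (q u) b)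

    touch-isSplitCharge : HaveTwins → IsSplitCharge touch
    touch-isSplitCharge twins C u fresh with lab u in ℓ
    ... | false = inj₁ refl
    ... | true with p u ⊨ C in p⊨C | q u ⊨ C in q⊨C
    ...   | true  | y     = inj₂ (meet-≤1 true y , twins-split (proj₂ (proj₁ (twins u ℓ))) fresh p⊨C)
    ...   | false | true  = inj₂ (≤-refl , twins-split (proj₂ (proj₂ (twins u ℓ))) fresh q⊨C)
    ...   | false | false = inj₁ refl

    labels : List (Fin n) → ℕ
    labels us = sum (map (boolToℕ ∘ lab) us)

    cost : List (Fin n) → Fin n → ℕ
    cost seen u = leafSum (λ D → touch D u) [] seen

    Separable : Set
    Separable = ∀ u → lab u ≡ true → ∃ λ w → w ∈ S × w ≢ u × test (p u) w ≢ test (q u) w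

    separated-∈ : ∀ {w a b} ws → w ∈ₗ ws → test a w ≢ test b w → T (separated ws a b)
    separated-∈ {_} {a} {b} ws w∈ws a≢b =
      any⁺ (λ w → test a w xor test b w) (Any.map (λ { refl → xor-≢ a≢b }) w∈ws)
      where
      xor-≢ : ∀ {x y} → x ≢ y → T (x xor y)
      xor-≢ {true}  {false} _   = _
      xor-≢ {false} {true}  _   = _
      xor-≢ {true}  {true}  x≢y = x≢y refl
      xor-≢ {false} {false} x≢y = x≢y refl

    three≤meet+meet : ∀ d d′ → T d ⊎ T d′ → 3 ≤ meet true true d + meet true true d′
    three≤meet+meet true  d′    _ = +-monoʳ-≤ 2 (s≤s z≤n)
    three≤meet+meet false true  _ = ≤-refl
    three≤meet+meet false false (inj₁ ())
    three≤meet+meet false false (inj₂ ())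

    three≤cost+cost : Separable → ∀ u seen us → (∀ w → w ∈ S → w ∈ₗ seen ⊎ w ∈ₗ u ∷ us) →
               3 * boolToℕ (lab u) ≤ cost seen u + cost (reverse us) u
    three≤cost+cost sep u seen us covered with lab u in ℓ
    ... | false = z≤n
    ... | true rewrite leafSum-meet (p u) (q u) [] seen | leafSum-meet (p u) (q u) [] (reverse us) =
      three≤meet+meet _ _ separated-somewhere
      where
      separated-somewhere : T (separated seen (p u) (q u)) ⊎ T (separated (reverse us) (p u) (q u))
      separated-somewhere with sep u ℓ
      ... | w , w∈S , w≢u , pw≢qw with covered w w∈S
      ...   | inj₁ w∈seen          = inj₁ (separated-∈ seen w∈seen pw≢qw)
      ...   | inj₂ (here w≡u)      = ⊥-elim (w≢u w≡u)
      ...   | inj₂ (there w∈us)    = inj₂ (separated-∈ (reverse us) (∈-resp-↭ (↭-sym (↭-reverse us)) w∈us) pw≢qw)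

    three-per-label : Separable → ∀ us seen → (∀ w → w ∈ S → w ∈ₗ seen ⊎ w ∈ₗ us) →
                      3 * labels us ≤ prefixSum cost seen us + prefixSum cost [] (reverse us)
    three-per-label sep []       seen covered = z≤n
    three-per-label sep (u ∷ us) seen covered
      rewrite unfold-reverse u us | prefixSum-∷ʳ cost [] (reverse us) u = begin
      3 * (boolToℕ (lab u) + labels us)
        ≡⟨ *-distribˡ-+ 3 (boolToℕ (lab u)) (labels us) ⟩
      3 * boolToℕ (lab u) + 3 * labels us
        ≤⟨ +-mono-≤ (three≤cost+cost sep u seen us covered) (three-per-label sep us (seen ∷ʳ u) covered′) ⟩
      (cost seen u + cost (reverse us) u) + (prefixSum cost (seen ∷ʳ u) us + prefixSum cost [] (reverse us))
        ≡⟨ regroup (cost seen u) (cost (reverse us) u) _ _ ⟩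
      (cost seen u + prefixSum cost (seen ∷ʳ u) us) + (prefixSum cost [] (reverse us) + cost (reverse us) u) ∎
      where
      open ≤-Reasoning
      regroup : ∀ a b c d → (a + b) + (c + d) ≡ (a + c) + (d + b)
      regroup a b c d = trans (interchange a b c d) (cong ((a + c) +_) (+-comm b d))
      covered′ : ∀ w → w ∈ S → w ∈ₗ seen ∷ʳ u ⊎ w ∈ₗ us
      covered′ w w∈S with covered w w∈S
      ... | inj₁ w∈seen       = inj₁ (∈-++⁺ˡ w∈seen)
      ... | inj₂ (here w≡u)   = inj₁ (∈-++⁺ʳ seen (here w≡u))
      ... | inj₂ (there w∈us) = inj₂ w∈us

    3*labels≤2*[size∸1] : HaveTwins → Separable → ∀ us → Unique us → All (_∈ S) us → (∀ w → w ∈ S → w ∈ₗ us) →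
                  3 * labels us ≤ 2 * (size V ∸ 1)
    3*labels≤2*[size∸1] twins sep us us! us⊆S complete = begin
      3 * labels us
        ≤⟨ three-per-label sep us [] (λ w w∈S → inj₂ (complete w w∈S)) ⟩
      prefixSum cost [] us + prefixSum cost [] (reverse us)
        ≡⟨ sym (cong₂ _+_ (total≡prefixSum touch [] us) (total≡prefixSum touch [] (reverse us))) ⟩
      total touch [] us + total touch [] (reverse us)
        ≤⟨ +-mono-≤ (bound us us! us⊆S) (bound (reverse us) (reverse-unique us!) (All-resp-↭ us↭rev us⊆S)) ⟩
      (size V ∸ 1) + (size V ∸ 1)
        ≡⟨ cong ((size V ∸ 1) +_) (sym (+-identityʳ (size V ∸ 1))) ⟩
      2 * (size V ∸ 1) ∎
      where
      open ≤-Reasoning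
      us↭rev : us ↭ reverse us
      us↭rev = ↭-sym (↭-reverse us)
      reverse-unique : Unique us → Unique (reverse us)
      reverse-unique = Permutationₛ.Unique-resp-↭ (setoid (Fin n)) (↭⇒↭ₛ us↭rev)
      bound : ∀ vs → Unique vs → All (_∈ S) vs → total touch [] vs ≤ size V ∸ 1
      bound vs vs! vs⊆S = total≤size∸1 (touch-isSplitCharge twins) vs [] vs! vs⊆S []

lower upper : ∀ {n} → Graph n → Edge n → Fin n → Fin n
lower G (x , y) u = if adj G x u then y else x
upper G (x , y) u = if adj G x u then x else y

lower-endpoint : ∀ {n} (G : Graph n) e u → lower G e u ≡ proj₁ e ⊎ lower G e u ≡ proj₂ e
lower-endpoint G (x , y) u with adj G x u
... | true  = inj₂ refl
... | false = inj₁ refl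

upper-endpoint : ∀ {n} (G : Graph n) e u → upper G e u ≡ proj₁ e ⊎ upper G e u ≡ proj₂ e
upper-endpoint G (x , y) u with adj G x u
... | true  = inj₁ refl
... | false = inj₂ refl

LabelledEdge-sym : ∀ {n} (G : Graph n) S {x y u} → LabelledEdge G S x y u → LabelledEdge G S y x u
LabelledEdge-sym G S (x∉S , y∉S , u∈S , xᵤ≢yᵤ , agree) =
  y∉S , x∉S , u∈S , xᵤ≢yᵤ ∘ sym , λ w w∈S w≢u → sym (agree w w∈S w≢u)

orient : ∀ {n} (G : Graph n) (S : Subset n) {x y u} → LabelledEdge G S x y u →
         LabelledEdge G S (lower G (x , y) u) (upper G (x , y) u) u × adj G (lower G (x , y) u) u ≡ false
orient G S {x} {y} {u} ℓ = by-cases (adj G x u) refl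
  where
  by-cases : ∀ b → adj G x u ≡ b →
             LabelledEdge G S (if b then y else x) (if b then x else y) u × adj G (if b then y else x) u ≡ false
  by-cases true  xᵤ = LabelledEdge-sym G S ℓ , ¬-not (λ yᵤ → proj₁ (proj₂ (proj₂ (proj₂ ℓ))) (trans xᵤ (sym yᵤ)))
  by-cases false xᵤ = ℓ , xᵤ

upper-adjacent : ∀ {n} (G : Graph n) (S : Subset n) {e u} → HasLabel G S e u → adj G (upper G e u) u ≡ true
upper-adjacent G S {_ , _} ℓ with orient G S ℓ
... | (_ , _ , _ , lᵤ≢uᵤ , _) , lᵤ≡false rewrite lᵤ≡false = ¬-not (lᵤ≢uᵤ ∘ sym)

lower-upper-injective : ∀ {n} (G : Graph n) {e e′ u} → Ordered e → Ordered e′ →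
                        lower G e u ≡ lower G e′ u → upper G e u ≡ upper G e′ u → e ≡ e′
lower-upper-injective G {x , y} {x′ , y′} {u} x<y x′<y′ = by-cases (adj G x u) (adj G x′ u)
  where
  crossed : y ≡ x′ → x ≡ y′ → (x , y) ≡ (x′ , y′)
  crossed refl refl = ⊥-elim (<-asym x<y x′<y′)
  by-cases : ∀ b b′ → (if b then y else x) ≡ (if b′ then y′ else x′) →
             (if b then x else y) ≡ (if b′ then x′ else y′) → (x , y) ≡ (x′ , y′)
  by-cases true  true  y≡y′ x≡x′ = cong₂ _,_ x≡x′ y≡y′
  by-cases false false x≡x′ y≡y′ = cong₂ _,_ x≡x′ y≡y′
  by-cases true  false y≡x′ x≡y′ = crossed y≡x′ x≡y′
  by-cases false true  x≡y′ y≡x′ = crossed y≡x′ x≡y′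

distinguishing-witness : ∀ {n} (G : Graph n) (S : Subset n) → Distinguishing G S →
                         ∀ {x y} → x ∉ S → y ∉ S → x ≢ y → ∃ λ w → w ∈ S × adj G x w ≢ adj G y w
distinguishing-witness {n} G S dist {x} {y} x∉S y∉S x≢y
  with ¬∀⟶∃¬ n (λ w → w ∈ S → adj G x w ≡ adj G y w)
              (λ w → w ∈? S →-dec adj G x w Bool.≟ adj G y w) (dist x y x∉S y∉S x≢y)
... | w , ¬agree with w ∈? S
...   | yes w∈S = w , w∈S , λ xw≡yw → ¬agree (λ _ → xw≡yw)
...   | no  w∉S = ⊥-elim (¬agree (λ w∈S → ⊥-elim (w∉S w∈S)))

module _ {n} (G : Graph n) (S : Subset n) (dist : Distinguishing G S) where

  lower-injective : ∀ {e e′ u} → Ordered e → Ordered e′ → HasLabel G S e u → HasLabel G S e′ u →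
                    lower G e u ≡ lower G e′ u → e ≡ e′
  lower-injective {e@(_ , _)} {e′@(_ , _)} {u} e< e′< ℓ ℓ′ l≡l′ = lower-upper-injective G e< e′< l≡l′ uppers-equal
    where
    uppers-equal : upper G e u ≡ upper G e′ u
    uppers-equal with orient G S ℓ | orient G S ℓ′
    ... | (_ , h∉S , _ , _ , agree) , _ | (_ , h′∉S , _ , _ , agree′) , _ =
      decidable-stable (upper G e u ≟ upper G e′ u) (λ h≢h′ → dist _ _ h∉S h′∉S h≢h′ same-trace)
      where
      same-trace : SameTrace G S (upper G e u) (upper G e′ u)
      same-trace w w∈S with w ≟ u
      ... | yes refl = trans (upper-adjacent G S ℓ) (sym (upper-adjacent G S ℓ′))
      ... | no  w≢u  = trans (sym (agree w w∈S w≢u)) (trans (cong (λ v → adj G v w) l≡l′) (agree′ w w∈S w≢u))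

  lowers-separated : ∀ {e e′ u} → Ordered e → Ordered e′ → e ≢ e′ → HasLabel G S e u → HasLabel G S e′ u →
                     ∃ λ w → w ∈ S × w ≢ u × adj G (lower G e u) w ≢ adj G (lower G e′ u) w
  lowers-separated {_ , _} {_ , _} {u} e< e′< e≢e′ ℓ ℓ′ with orient G S ℓ | orient G S ℓ′
  ... | (l∉S , _) , lᵤ≡false | (l′∉S , _) , l′ᵤ≡false
    with distinguishing-witness G S dist l∉S l′∉S (e≢e′ ∘ lower-injective e< e′< ℓ ℓ′)
  ... | w , w∈S , lw≢l′w = w , w∈S , w≢u , lw≢l′w
    where
    w≢u : w ≢ u
    w≢u refl = lw≢l′w (trans lᵤ≡false (sym l′ᵤ≡false))

module EdgeFamily {n} (G : Graph n) (S S′ : Subset n) (F : List (Edge n)) (tpl : TwoPerLabel G S S′ F) where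

  inH : Fin n → Bool
  inH v = any (λ e → ⌊ v ≟ proj₁ e ⌋ ∨ ⌊ v ≟ proj₂ e ⌋) F

  open Refinement (adj G) inH S

  endpoint∈H : ∀ {e v} → e ∈ₗ F → v ≡ proj₁ e ⊎ v ≡ proj₂ e → inH v ≡ true
  endpoint∈H {v = v} e∈F v∈e = Equivalence.to T-≡ (any⁺ _ (Any.map (λ { refl → is-endpoint v∈e }) e∈F))
    where
    is-endpoint : ∀ {x y} → v ≡ x ⊎ v ≡ y → T (⌊ v ≟ x ⌋ ∨ ⌊ v ≟ y ⌋)
    is-endpoint (inj₁ refl) = Equivalence.from T-∨ (inj₁ (fromWitness {a? = v ≟ v} refl))
    is-endpoint (inj₂ refl) = Equivalence.from T-∨ (inj₂ (fromWitness {a? = v ≟ v} refl))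

  twins-of : ∀ {e u} → e ∈ₗ F → HasLabel G S e u → Twins u (lower G e u) (upper G e u)
  twins-of {e@(_ , _)} {u} e∈F ℓ with orient G S ℓ
  ... | (_ , _ , _ , lᵤ≢hᵤ , agree) , _ =
    endpoint∈H e∈F (lower-endpoint G e u) , endpoint∈H e∈F (upper-endpoint G e u) , lᵤ≢hᵤ , agree

  LabelPair : Fin n → Edge n × Edge n → Set
  LabelPair u (e₁ , e₂) = e₁ ∈ₗ F × e₂ ∈ₗ F × e₁ ≢ e₂ × HasLabel G S e₁ u × HasLabel G S e₂ u

  -- (u , u) is a junk value; only labelled u are ever inspected.
  chosen : ∀ u → Dec (u ∈ S′) → Edge n × Edge n
  chosen u (yes u∈S′) = let (e₁ , e₂ , _) = proj₂ (proj₂ tpl) u u∈S′ in e₁ , e₂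
  chosen u (no _)     = (u , u) , (u , u)

  chosen-labelPair : ∀ u (d : Dec (u ∈ S′)) → does d ≡ true → LabelPair u (chosen u d)
  chosen-labelPair u (yes u∈S′) _ =
    let (_ , _ , e₁∈F , e₂∈F , e₁≢e₂ , ℓ₁ , ℓ₂ , _) = proj₂ (proj₂ tpl) u u∈S′ in e₁∈F , e₂∈F , e₁≢e₂ , ℓ₁ , ℓ₂

  lab : Fin n → Bool
  lab u = does (u ∈? S′)

  first second : Fin n → Edge n
  first  u = proj₁ (chosen u (u ∈? S′))
  second u = proj₂ (chosen u (u ∈? S′))

  open Labelling lab (λ u → lower G (first u) u) (λ u → lower G (second u) u) public

  twins : HaveTwins
  twins u ℓ =
    let (e₁∈F , e₂∈F , _ , ℓ₁ , ℓ₂) = chosen-labelPair u (u ∈? S′) ℓ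
    in (_ , twins-of e₁∈F ℓ₁) , (_ , twins-of e₂∈F ℓ₂)

  separable : Distinguishing G S → Separable
  separable dist u ℓ =
    let (e₁∈F , e₂∈F , e₁≢e₂ , ℓ₁ , ℓ₂) = chosen-labelPair u (u ∈? S′) ℓ
    in lowers-separated G S dist (ordered e₁∈F) (ordered e₂∈F) e₁≢e₂ ℓ₁ ℓ₂
    where
    ordered : ∀ {e} → e ∈ₗ F → Ordered e
    ordered e∈F = proj₁ (proj₁ (proj₂ tpl) _ e∈F)

elements : ∀ {n} → Subset n → List (Fin n)
elements []          = []
elements (true ∷ s)  = zero ∷ map suc (elements s)
elements (false ∷ s) = map suc (elements s)

elements-complete : ∀ {n} (s : Subset n) {x} → x ∈ s → x ∈ₗ elements s
elements-complete (true ∷ s)  V.here        = here refl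
elements-complete (true ∷ s)  (V.there x∈s) = there (∈-map⁺ suc (elements-complete s x∈s))
elements-complete (false ∷ s) (V.there x∈s) = ∈-map⁺ suc (elements-complete s x∈s)

elements-sound : ∀ {n} (s : Subset n) → All (_∈ s) (elements s)
elements-sound []          = []
elements-sound (true ∷ s)  = V.here ∷ All-map⁺ (All.map V.there (elements-sound s))
elements-sound (false ∷ s) = All-map⁺ (All.map V.there (elements-sound s))

elements-unique : ∀ {n} (s : Subset n) → Unique (elements s)
elements-unique []          = []
elements-unique (true ∷ s)  =
  All-map⁺ (All.universal (λ _ ()) (elements s)) ∷ Unique-map⁺ suc-injective (elements-unique s)
elements-unique (false ∷ s) = Unique-map⁺ suc-injective (elements-unique s)

count-elements : ∀ {n} (s s′ : Subset n) → s′ ⊆ s →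
                 sum (map (boolToℕ ∘ does ∘ (_∈? s′)) (elements s)) ≡ ∣ s′ ∣
count-elements []          []           _    = refl
count-elements (true ∷ s)  (true ∷ s′)  s′⊆s =
  cong suc (trans (cong sum (sym (map-∘ (elements s)))) (count-elements s s′ (drop-∷-⊆ s′⊆s)))
count-elements (true ∷ s)  (false ∷ s′) s′⊆s =
  trans (cong sum (sym (map-∘ (elements s)))) (count-elements s s′ (drop-∷-⊆ s′⊆s))
count-elements (false ∷ s) (true ∷ s′)  s′⊆s with () ← s′⊆s V.here
count-elements (false ∷ s) (false ∷ s′) s′⊆s =
  trans (cong sum (sym (map-∘ (elements s)))) (count-elements s s′ (drop-∷-⊆ s′⊆s))

three-halves : ∀ {k m} → 1 ≤ k → 3 * k ≤ 2 * (m ∸ 1) → 3 * k + 2 ≤ 2 * m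
three-halves {suc k} {zero}  _ ()
three-halves {suc k} {suc m} _ 3k≤2m = begin
  3 * suc k + 2  ≤⟨ +-monoˡ-≤ 2 3k≤2m ⟩
  2 * m + 2      ≡⟨ +-comm (2 * m) 2 ⟩
  2 + 2 * m      ≡⟨ sym (*-suc 2 m) ⟩
  2 * suc m      ∎
  where open ≤-Reasoning

corollary11 : ∀ {n} (G : Graph n) (S S' : Subset n) → Distinguishing G S →
    Nonempty S' → S' ⊆ S → (F : List (Edge n)) → TwoPerLabel G S S' F →
    3 * ∣ S' ∣ + 2 ≤ 2 * ∣ endpoints F ∣
corollary11 G S S' dist (u , u∈S') S'⊆S F tpl = three-halves {m = ∣ endpoints F ∣} ∣S'∣≥1 counting
  where
  open EdgeFamily G S S' F tpl
  ∣S'∣≥1 : 1 ≤ ∣ S' ∣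
  ∣S'∣≥1 = ≤-trans (s≤s z≤n) (x∈p⇒∣p-x∣<∣p∣ u∈S')
  counting : 3 * ∣ S' ∣ ≤ 2 * (∣ endpoints F ∣ ∸ 1)
  counting = subst (λ k → 3 * k ≤ 2 * (∣ endpoints F ∣ ∸ 1)) (count-elements S S' S'⊆S)
    (3*labels≤2*[size∸1] twins (separable dist) (elements S)
      (elements-unique S) (elements-sound S) (λ _ → elements-complete S))
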